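{- Let $a_1,\ldots,a_m$ be positive integers satisfying: for every $i=2,\ldots,m$ there exists $j<i$ such that $\operatorname{lcm}(\gcd(a_1,\ldots,a_{i-1}),a_i)=\operatorname{lcm}(a_j,a_i)$. For $i=2,\ldots,m$ put $\ell_i=\operatorname{lcm}(\gcd(a_1,\ldots,a_{i-1}),a_i)$, and let $S=S(a_1,\ldots,a_m)=\{\sum_{i=1}^m x_ia_i : x_1,\ldots,x_m\in\{0,1,2,\ldots\}\}$. Then in the ring of formal power series in $q$, $$\sum_{k\in S}q^k=\frac{\prod_{i=2}^m(1-q^{\ell_i})}{\prod_{i=1}^m(1-q^{a_i})}.$$
   Context: $\gcd$ and $\operatorname{lcm}$ denote greatest common divisor and least common multiple. -}

module Defs where

open import Data.Nat using (ℕ; zero; suc; _+_; _*_; _∸_; _≡ᵇ_)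
open import Data.Nat.GCD using (gcd)
open import Data.Nat.LCM using (lcm)
open import Data.Integer using (ℤ; 0ℤ; 1ℤ) renaming (_+_ to _+ℤ_; _*_ to _*ℤ_; _-_ to _-ℤ_)
open import Data.Bool using (if_then_else_)
open import Data.Product using (∃-syntax; Σ-syntax)
open import Relation.Binary.PropositionalEquality using (_≡_)

-- Formal power series in q with integer coefficients: n ↦ coefficient of q^n.
PS : Set
PS = ℕ → ℤ

sumTo : ℕ → (ℕ → ℤ) → ℤ
sumTo zero    f = f 0
sumTo (suc n) f = sumTo n f +ℤ f (suc n)

_⊛_ : PS → PS → PS
(f ⊛ g) n = sumTo n (λ i → f i *ℤ g (n ∸ i))

infixl 7 _⊛_

onePS : PS
onePS zero    = 1ℤ
onePS (suc _) = 0ℤ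

qPow : ℕ → PS
qPow a n = if a ≡ᵇ n then 1ℤ else 0ℤ

oneMinusQ : ℕ → PS
oneMinusQ a n = onePS n -ℤ qPow a n

-- prodFrom s n f = f s ⊛ f (s+1) ⊛ ... ⊛ f (s+n-1)   (n factors; empty product = 1)
prodFrom : ℕ → ℕ → (ℕ → PS) → PS
prodFrom s zero    f = onePS
prodFrom s (suc n) f = prodFrom s n f ⊛ f (s + n)

natSum1 : ℕ → (ℕ → ℕ) → ℕ
natSum1 zero    f = 0
natSum1 (suc m) f = natSum1 m f + f (suc m)

-- gcd(a_1, ..., a_k)   (gcd of the empty family is 0, gcd(0,x) = x)
gcdUpTo : (ℕ → ℕ) → ℕ → ℕ
gcdUpTo a zero    = 0
gcdUpTo a (suc k) = gcd (gcdUpTo a k) (a (suc k))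

ell : (ℕ → ℕ) → ℕ → ℕ
ell a i = lcm (gcdUpTo a (i ∸ 1)) (a i)

InS : ℕ → (ℕ → ℕ) → ℕ → Set
InS m a k = Σ[ x ∈ (ℕ → ℕ) ] (natSum1 m (λ i → x i * a i) ≡ k)

-- Let χₘ be the indicator series of Sₘ = S(a₁,…,aₘ).  For P ⊆ ℕ with
-- c + P ⊆ P, the series (1 - q^c)·χ_P is the indicator of the Apéry set
-- Ap(P, c) = P ∖ (c + P).  With b = a_{m+1}, g = gcd(a₁,…,aₘ) and
-- ℓ = lcm(g, b), the hypothesis ℓ = lcm(aⱼ, b) puts all multiples of ℓ in
-- Sₘ, and then Ap(Sₘ + bℕ, b) = Ap(Sₘ, ℓ) (the Apéry step).  Hence
-- (1 - q^b)·χ_{m+1} = (1 - q^ℓ)·χₘ, and induction on m gives the theorem.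

module Submission where

open import Defs
open import Data.Nat
  using (ℕ; zero; suc; _+_; _*_; _∸_; _≤_; _<_; _≤?_; _≟_; _≡ᵇ_; z≤n; s≤s; >-nonZero)
import Data.Nat.Properties as ℕP
open import Data.Nat.Divisibility using (_∣_; divides; ∣-refl; ∣-trans; ∣m∣n⇒∣m+n; ∣m+n∣m⇒∣n; n∣m*n)
open import Data.Nat.GCD using (gcd; gcd[m,n]∣m; gcd[m,n]∣n; gcd[m,n]≢0)
open import Data.Nat.LCM using (lcm; m∣lcm[m,n]; n∣lcm[m,n]; lcm-least; gcd*lcm)
open import Algebra.Properties.CommutativeSemigroup ℕP.+-commutativeSemigroup
  using ()
  renaming (x∙yz≈y∙xz to x+[y+z]≡y+[x+z]; x∙yz≈xz∙y to x+[y+z]≡x+z+y; interchange to +-interchange)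
open import Data.Integer as ℤ using (ℤ; 0ℤ; 1ℤ)
import Data.Integer.Properties as ℤP
import Data.Integer.Tactic.RingSolver as ℤSolver
open import Data.Bool using (true; false; if_then_else_; T)
open import Data.Product using (_×_; _,_; proj₁; proj₂; ∃-syntax)
open import Data.Sum using (inj₁; inj₂)
open import Function using (_∘_)
open import Function.Bundles using (_⇔_; mk⇔; Equivalence)
open import Function.Construct.Symmetry using (⇔-sym)
open import Function.Construct.Composition using (_⇔-∘_)
open import Relation.Nullary using (¬_; Dec; yes; no; does; contradiction)
open import Relation.Nullary.Decidable
  using (_×-dec_; ¬?; dec-true; dec-false) renaming (map to map-dec)
open import Relation.Unary using (Decidable)
open import Relation.Binary.PropositionalEquality
import Relation.Binary.Reasoning.Setoid as SetoidReasoning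

open Equivalence using (to; from)

module ≗-Reasoning = SetoidReasoning (ℕ →-setoid ℤ)

sumTo-cong : ∀ n {F G : ℕ → ℤ} → (∀ i → i ≤ n → F i ≡ G i) → sumTo n F ≡ sumTo n G
sumTo-cong zero    F≡G = F≡G 0 z≤n
sumTo-cong (suc n) F≡G =
  cong₂ ℤ._+_ (sumTo-cong n (λ i i≤n → F≡G i (ℕP.m≤n⇒m≤1+n i≤n))) (F≡G (suc n) ℕP.≤-refl)

sumTo-zero : ∀ n {F : ℕ → ℤ} → (∀ i → i ≤ n → F i ≡ 0ℤ) → sumTo n F ≡ 0ℤ
sumTo-zero n F≡0 = trans (sumTo-cong n F≡0) (sumTo-const n)
  where
  sumTo-const : ∀ n → sumTo n (λ _ → 0ℤ) ≡ 0ℤ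
  sumTo-const zero    = refl
  sumTo-const (suc n) = cong (ℤ._+ 0ℤ) (sumTo-const n)

sumTo-first : ∀ n (F : ℕ → ℤ) → sumTo (suc n) F ≡ F 0 ℤ.+ sumTo n (F ∘ suc)
sumTo-first zero    F = refl
sumTo-first (suc n) F = trans (cong (ℤ._+ F (suc (suc n))) (sumTo-first n F)) (ℤP.+-assoc (F 0) _ _)

-- Reversing the order of summation; this is what makes ⊛ commutative.
sumTo-reverse : ∀ n (F : ℕ → ℤ) → sumTo n F ≡ sumTo n (λ i → F (n ∸ i))
sumTo-reverse zero    F = refl
sumTo-reverse (suc n) F = begin
  sumTo n F ℤ.+ F (suc n)                  ≡⟨ cong (ℤ._+ F (suc n)) (sumTo-reverse n F) ⟩
  sumTo n (λ i → F (n ∸ i)) ℤ.+ F (suc n)  ≡⟨ ℤP.+-comm _ (F (suc n)) ⟩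
  F (suc n) ℤ.+ sumTo n (λ i → F (n ∸ i))  ≡⟨ sumTo-first n (λ i → F (suc n ∸ i)) ⟨
  sumTo (suc n) (λ i → F (suc n ∸ i))      ∎
  where open ≡-Reasoning

sumTo-minus : ∀ n (F G : ℕ → ℤ) → sumTo n (λ i → F i ℤ.- G i) ≡ sumTo n F ℤ.- sumTo n G
sumTo-minus zero    F G = refl
sumTo-minus (suc n) F G =
  trans (cong (ℤ._+ (F (suc n) ℤ.- G (suc n))) (sumTo-minus n F G))
        (interchange (sumTo n F) (sumTo n G) (F (suc n)) (G (suc n)))
  where
  interchange : ∀ a b c d → (a ℤ.- b) ℤ.+ (c ℤ.- d) ≡ (a ℤ.+ c) ℤ.- (b ℤ.+ d)
  interchange = ℤSolver.solve-∀

sumTo-truncate : ∀ N p {F : ℕ → ℤ} → p ≤ N → (∀ i → p < i → i ≤ N → F i ≡ 0ℤ) →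
                 sumTo N F ≡ sumTo p F
sumTo-truncate zero    zero z≤n _ = refl
sumTo-truncate (suc N) p p≤1+N F≡0 with p ≤? N
... | yes p≤N =
  trans (cong₂ ℤ._+_ (sumTo-truncate N p p≤N (λ i p<i i≤N → F≡0 i p<i (ℕP.m≤n⇒m≤1+n i≤N)))
                     (F≡0 (suc N) (s≤s p≤N) ℕP.≤-refl))
        (ℤP.+-identityʳ _)
... | no p≰N with ℕP.≤-antisym p≤1+N (ℕP.≰⇒> p≰N)
...   | refl = refl

infixl 6 _⊖_

_⊖_ : PS → PS → PS
(f ⊖ g) n = f n ℤ.- g n

shift : ℕ → PS → PS
shift a h n = if does (a ≤? n) then h (n ∸ a) else 0ℤ

shift-≤ : ∀ {a n} h → a ≤ n → shift a h n ≡ h (n ∸ a)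
shift-≤ {a} {n} h a≤n rewrite dec-true (a ≤? n) a≤n = refl

shift-≰ : ∀ {a n} h → ¬ a ≤ n → shift a h n ≡ 0ℤ
shift-≰ {a} {n} h a≰n rewrite dec-false (a ≤? n) a≰n = refl

⊛-congˡ : ∀ f {g g′} → g ≗ g′ → f ⊛ g ≗ f ⊛ g′
⊛-congˡ f g≗g′ n = sumTo-cong n (λ i _ → cong (f i ℤ.*_) (g≗g′ (n ∸ i)))

⊛-congʳ : ∀ {f f′} g → f ≗ f′ → f ⊛ g ≗ f′ ⊛ g
⊛-congʳ g f≗f′ n = sumTo-cong n (λ i _ → cong (ℤ._* g (n ∸ i)) (f≗f′ i))

⊛-comm : ∀ f g → f ⊛ g ≗ g ⊛ f
⊛-comm f g n = trans (sumTo-reverse n _) (sumTo-cong n (λ i i≤n →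
  trans (cong (λ k → f (n ∸ i) ℤ.* g k) (ℕP.m∸[m∸n]≡n i≤n)) (ℤP.*-comm (f (n ∸ i)) (g i))))

⊛-distribʳ-⊖ : ∀ f g h → (f ⊖ g) ⊛ h ≗ (f ⊛ h) ⊖ (g ⊛ h)
⊛-distribʳ-⊖ f g h n =
  trans (sumTo-cong n (λ i _ → distrib (f i) (g i) (h (n ∸ i)))) (sumTo-minus n _ _)
  where
  distrib : ∀ x y z → (x ℤ.- y) ℤ.* z ≡ x ℤ.* z ℤ.- y ℤ.* z
  distrib = ℤSolver.solve-∀

⊛-distribˡ-⊖ : ∀ f g h → f ⊛ (g ⊖ h) ≗ (f ⊛ g) ⊖ (f ⊛ h)
⊛-distribˡ-⊖ f g h n =
  trans (sumTo-cong n (λ i _ → distrib (f i) (g (n ∸ i)) (h (n ∸ i)))) (sumTo-minus n _ _)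
  where
  distrib : ∀ x y z → x ℤ.* (y ℤ.- z) ≡ x ℤ.* y ℤ.- x ℤ.* z
  distrib = ℤSolver.solve-∀

qPow-refl : ∀ a → qPow a a ≡ 1ℤ
qPow-refl a with a ≡ᵇ a | ℕP.≡⇒≡ᵇ a a refl
... | true | _ = refl

qPow-≢ : ∀ {a i} → a ≢ i → qPow a i ≡ 0ℤ
qPow-≢ {a} {i} a≢i with a ≡ᵇ i in eq
... | true  = contradiction (ℕP.≡ᵇ⇒≡ a i (subst T (sym eq) _)) a≢i
... | false = refl

sumTo-qPow : ∀ n {a} (G : ℕ → ℤ) → a ≤ n → sumTo n (λ i → qPow a i ℤ.* G i) ≡ G a
sumTo-qPow-out : ∀ n {a} (G : ℕ → ℤ) → n < a → sumTo n (λ i → qPow a i ℤ.* G i) ≡ 0ℤ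
sumTo-qPow-out n {a} G n<a = sumTo-zero n (λ i i≤n →
  cong (ℤ._* G i) (qPow-≢ (λ a≡i → ℕP.<⇒≱ n<a (subst (_≤ n) (sym a≡i) i≤n))))
sumTo-qPow zero    G z≤n = ℤP.*-identityˡ (G 0)
sumTo-qPow (suc n) {a} G a≤1+n with a ≤? n
... | yes a≤n =
  trans (cong₂ ℤ._+_ (sumTo-qPow n G a≤n)
                     (cong (ℤ._* G (suc n)) (qPow-≢ (ℕP.<⇒≢ (s≤s a≤n)))))
        (ℤP.+-identityʳ (G a))
... | no a≰n with ℕP.≤-antisym a≤1+n (ℕP.≰⇒> a≰n)
...   | refl =
  trans (cong₂ ℤ._+_ (sumTo-qPow-out n G ℕP.≤-refl) (cong (ℤ._* G (suc n)) (qPow-refl (suc n))))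
        (trans (ℤP.+-identityˡ _) (ℤP.*-identityˡ (G (suc n))))

qPow-⊛ : ∀ a h → qPow a ⊛ h ≗ shift a h
qPow-⊛ a h n with a ≤? n
... | yes a≤n = trans (sumTo-qPow n (λ i → h (n ∸ i)) a≤n) (sym (shift-≤ h a≤n))
... | no a≰n  = trans (sumTo-qPow-out n (λ i → h (n ∸ i)) (ℕP.≰⇒> a≰n)) (sym (shift-≰ h a≰n))

onePS-⊛ : ∀ h → onePS ⊛ h ≗ h
onePS-⊛ h n = trans (⊛-congʳ h onePS≗qPow0 n) (trans (qPow-⊛ 0 h n) (shift-≤ h z≤n))
  where
  onePS≗qPow0 : onePS ≗ qPow 0
  onePS≗qPow0 zero    = refl
  onePS≗qPow0 (suc _) = refl

oneMinusQ-⊛ : ∀ a h → oneMinusQ a ⊛ h ≗ h ⊖ shift a h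
oneMinusQ-⊛ a h n =
  trans (⊛-distribʳ-⊖ onePS (qPow a) h n) (cong₂ ℤ._-_ (onePS-⊛ h n) (qPow-⊛ a h n))

⊛-shift : ∀ a f h → f ⊛ shift a h ≗ shift a (f ⊛ h)
⊛-shift a f h n with a ≤? n
... | no a≰n =
  trans (sumTo-zero n (λ i _ → trans (cong (f i ℤ.*_)
                                        (shift-≰ h (λ a≤n∸i → a≰n (ℕP.≤-trans a≤n∸i (ℕP.m∸n≤m n i)))))
                                      (ℤP.*-zeroʳ (f i))))
        (sym (shift-≰ (f ⊛ h) a≰n))
... | yes a≤n =
  trans (sumTo-truncate n (n ∸ a) (ℕP.m∸n≤m n a) beyond)
        (trans (sumTo-cong (n ∸ a) within) (sym (shift-≤ (f ⊛ h) a≤n)))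
  where
  beyond : ∀ i → n ∸ a < i → i ≤ n → f i ℤ.* shift a h (n ∸ i) ≡ 0ℤ
  beyond i n∸a<i i≤n = trans (cong (f i ℤ.*_) (shift-≰ h (λ a≤n∸i →
      ℕP.<⇒≱ n∸a<i (ℕP.m+n≤o⇒m≤o∸n i (subst (_≤ n) (ℕP.+-comm a i) (ℕP.m≤o∸n⇒m+n≤o a i≤n a≤n∸i))))))
    (ℤP.*-zeroʳ (f i))
  within : ∀ i → i ≤ n ∸ a → f i ℤ.* shift a h (n ∸ i) ≡ f i ℤ.* h (n ∸ a ∸ i)
  within i i≤n∸a = cong (f i ℤ.*_) (trans
    (shift-≤ h (ℕP.m+n≤o⇒m≤o∸n a (subst (_≤ n) (ℕP.+-comm i a) (ℕP.m≤o∸n⇒m+n≤o i a≤n i≤n∸a))))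
    (cong h (trans (ℕP.∸-+-assoc n i a)
            (trans (cong (n ∸_) (ℕP.+-comm i a)) (sym (ℕP.∸-+-assoc n a i))))))

⊛-assoc-oneMinusQ : ∀ f g a → f ⊛ (g ⊛ oneMinusQ a) ≗ (f ⊛ g) ⊛ oneMinusQ a
⊛-assoc-oneMinusQ f g a = begin
  f ⊛ (g ⊛ A)                   ≈⟨ ⊛-congˡ f (⊛-comm g A) ⟩
  f ⊛ (A ⊛ g)                   ≈⟨ ⊛-congˡ f (oneMinusQ-⊛ a g) ⟩
  f ⊛ (g ⊖ shift a g)           ≈⟨ ⊛-distribˡ-⊖ f g (shift a g) ⟩
  (f ⊛ g) ⊖ (f ⊛ shift a g)     ≈⟨ (λ n → cong (ℤ._-_ ((f ⊛ g) n)) (⊛-shift a f g n)) ⟩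
  (f ⊛ g) ⊖ shift a (f ⊛ g)     ≈⟨ oneMinusQ-⊛ a (f ⊛ g) ⟨
  A ⊛ (f ⊛ g)                   ≈⟨ ⊛-comm A (f ⊛ g) ⟩
  (f ⊛ g) ⊛ A                   ∎
  where
  open ≗-Reasoning
  A : PS
  A = oneMinusQ a

IsIndicator : (ℕ → Set) → PS → Set
IsIndicator P χ = ∀ k → (P k → χ k ≡ 1ℤ) × (¬ P k → χ k ≡ 0ℤ)

Shifted : ℕ → (ℕ → Set) → ℕ → Set
Shifted c P n = c ≤ n × P (n ∸ c)

Apery : (ℕ → Set) → ℕ → ℕ → Set
Apery P c n = P n × ¬ Shifted c P n

shifted-intro : ∀ {c w n} (P : ℕ → Set) → c + w ≡ n → P w → Shifted c P n
shifted-intro {c} {w} P c+w≡n Pw =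
  subst (c ≤_) c+w≡n (ℕP.m≤m+n c w) ,
  subst P (sym (trans (cong (_∸ c) (sym c+w≡n)) (ℕP.m+n∸m≡n c w))) Pw

shifted-split : ∀ {c n} {P : ℕ → Set} → Shifted c P n → c + (n ∸ c) ≡ n
shifted-split (c≤n , _) = ℕP.m+[n∸m]≡n c≤n

shifted-closed : ∀ {P : ℕ → Set} {c n} → (∀ {u v} → P u → P v → P (u + v)) → P c →
                 Shifted c P n → P n
shifted-closed {P} P-+ Pc sh@(_ , Pn∸c) = subst P (shifted-split {P = P} sh) (P-+ Pc Pn∸c)

shifted-dec : ∀ {P : ℕ → Set} c → Decidable P → Decidable (Shifted c P)
shifted-dec c P? n = (c ≤? n) ×-dec P? (n ∸ c)

apery-dec : ∀ {P : ℕ → Set} c → Decidable P → Decidable (Apery P c)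
apery-dec c P? n = P? n ×-dec ¬? (shifted-dec c P? n)

apery-cong : ∀ {P Q : ℕ → Set} {c n} → (∀ {k} → P k ⇔ Q k) → Apery P c n ⇔ Apery Q c n
apery-cong P⇔Q = mk⇔
  (λ (Pn , ¬sh) → to P⇔Q Pn , λ (c≤n , Q) → ¬sh (c≤n , from P⇔Q Q))
  (λ (Qn , ¬sh) → from P⇔Q Qn , λ (c≤n , P) → ¬sh (c≤n , to P⇔Q P))

indicator : ∀ {P : ℕ → Set} → Decidable P → PS
indicator P? k with P? k
... | yes _ = 1ℤ
... | no _  = 0ℤ

indicator-spec : ∀ {P : ℕ → Set} (P? : Decidable P) → IsIndicator P (indicator P?)
indicator-spec P? k with P? k
... | yes Pk = (λ _ → refl) , (λ ¬Pk → contradiction Pk ¬Pk)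
... | no ¬Pk = (λ Pk → contradiction Pk ¬Pk) , (λ _ → refl)

indicator-unique : ∀ {P Q : ℕ → Set} {χ ψ : PS} → Decidable P → (∀ {k} → P k ⇔ Q k) →
                   IsIndicator P χ → IsIndicator Q ψ → χ ≗ ψ
indicator-unique P? P⇔Q χ-spec ψ-spec k with P? k
... | yes Pk = trans (proj₁ (χ-spec k) Pk) (sym (proj₁ (ψ-spec k) (to P⇔Q Pk)))
... | no ¬Pk = trans (proj₂ (χ-spec k) ¬Pk) (sym (proj₂ (ψ-spec k) (¬Pk ∘ from P⇔Q)))

onePS-indicator : IsIndicator (_≡ 0) onePS
onePS-indicator zero    = (λ _ → refl) , (λ 0≢0 → contradiction refl 0≢0)
onePS-indicator (suc k) = (λ ()) , (λ _ → refl)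

shift-indicator : ∀ {P : ℕ → Set} {χ} c → IsIndicator P χ → IsIndicator (Shifted c P) (shift c χ)
shift-indicator {P} {χ} c χ-spec k =
  (λ (c≤k , P[k∸c]) → trans (shift-≤ χ c≤k) (proj₁ (χ-spec (k ∸ c)) P[k∸c])) ,
  λ ¬sh → case (c ≤? k) ¬sh
  where
  case : Dec (c ≤ k) → ¬ Shifted c P k → shift c χ k ≡ 0ℤ
  case (yes c≤k) ¬sh = trans (shift-≤ χ c≤k) (proj₂ (χ-spec (k ∸ c)) (λ P[k∸c] → ¬sh (c≤k , P[k∸c])))
  case (no c≰k)  _   = shift-≰ χ c≰k

apery-indicator : ∀ {P : ℕ → Set} {χ} c → Decidable P → (∀ {n} → Shifted c P n → P n) →
                  IsIndicator P χ → IsIndicator (Apery P c) (χ ⊛ oneMinusQ c)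
apery-indicator {P} {χ} c P? closed χ-spec k =
  (λ (Pk , ¬sh) → trans expand (cong₂ ℤ._-_ (proj₁ (χ-spec k) Pk) (proj₂ (shχ k) ¬sh))) ,
  (λ ¬ap → trans expand (outside ¬ap (P? k) (shifted-dec c P? k)))
  where
  shχ : IsIndicator (Shifted c P) (shift c χ)
  shχ = shift-indicator c χ-spec
  expand : (χ ⊛ oneMinusQ c) k ≡ χ k ℤ.- shift c χ k
  expand = trans (⊛-comm χ (oneMinusQ c) k) (oneMinusQ-⊛ c χ k)
  outside : ¬ Apery P c k → Dec (P k) → Dec (Shifted c P k) → χ k ℤ.- shift c χ k ≡ 0ℤ
  outside ¬ap (yes Pk) (yes sh) = cong₂ ℤ._-_ (proj₁ (χ-spec k) Pk) (proj₁ (shχ k) sh)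
  outside ¬ap (yes Pk) (no ¬sh) = contradiction (Pk , ¬sh) ¬ap
  outside ¬ap (no ¬Pk) _        =
    cong₂ ℤ._-_ (proj₂ (χ-spec k) ¬Pk) (proj₂ (shχ k) (¬Pk ∘ closed))

infixl 6 _⊕_

_⊕_ : (ℕ → Set) → ℕ → ℕ → Set
(S ⊕ b) n = ∃[ s ] ∃[ t ] (S s × s + t * b ≡ n)

⊕-inj : ∀ {S : ℕ → Set} {b n} → S n → (S ⊕ b) n
⊕-inj {n = n} Sn = n , 0 , Sn , ℕP.+-identityʳ n

-- Membership in S + bℕ is decidable: only t with t·b ≤ n need to be tried.
⊕-dec : ∀ {S : ℕ → Set} {b} → 0 < b → Decidable S → Decidable (S ⊕ b)
⊕-dec {S} {b} 0<b S? n = map-dec (mk⇔ found search)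
  (ℕP.anyUpTo? (λ t → t * b ≤? n ×-dec S? (n ∸ t * b)) (suc n))
  where
  found : ∃[ t ] (t < suc n × (t * b ≤ n × S (n ∸ t * b))) → (S ⊕ b) n
  found (t , _ , tb≤n , S[n∸tb]) = n ∸ t * b , t , S[n∸tb] , ℕP.m∸n+n≡m tb≤n
  search : (S ⊕ b) n → ∃[ t ] (t < suc n × (t * b ≤ n × S (n ∸ t * b)))
  search (s , t , Ss , s+tb≡n) = t , s≤s (ℕP.≤-trans t≤tb tb≤n) , tb≤n , subst S (sym n∸tb≡s) Ss
    where
    tb≤n : t * b ≤ n
    tb≤n = subst (t * b ≤_) s+tb≡n (ℕP.m≤n+m (t * b) s)
    t≤tb : t ≤ t * b
    t≤tb = ℕP.m≤m*n t b {{>-nonZero 0<b}}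
    n∸tb≡s : n ∸ t * b ≡ s
    n∸tb≡s = trans (cong (_∸ t * b) (sym s+tb≡n)) (ℕP.m+n∸n≡m s (t * b))

-- An element of Ap(S + bℕ, b) uses no copy of b, so it lies in S.
apery-⊕-⊆ : ∀ {S : ℕ → Set} {b n} → Apery (S ⊕ b) b n → S n
apery-⊕-⊆ {S} ((s , zero , Ss , s+0≡n) , _) = subst S (trans (sym (ℕP.+-identityʳ s)) s+0≡n) Ss
apery-⊕-⊆ {S} {b} ((s , suc t , Ss , e) , ¬sh) =
  contradiction (shifted-intro (S ⊕ b) (trans (x+[y+z]≡y+[x+z] b s (t * b)) e) (s , t , Ss , refl)) ¬sh

apery-⊕-zero : ∀ {S : ℕ → Set} {b n} → 0 < b → (∀ {k} → S k ⇔ k ≡ 0) →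
               Apery (S ⊕ b) b n ⇔ n ≡ 0
apery-⊕-zero 0<b S⇔0 = mk⇔ (to S⇔0 ∘ apery-⊕-⊆)
  (λ { refl → ⊕-inj (from S⇔0 refl) , λ (b≤0 , _) → ℕP.<⇒≱ 0<b b≤0 })

product-pos : ∀ {m n} → 0 < m → 0 < n → 0 < m * n
product-pos {suc m} {suc n} _ _ = ℕP.0<1+n

lcm-pos : ∀ {m n} → 0 < m → 0 < n → 0 < lcm m n
lcm-pos {m} {n} 0<m 0<n = ℕP.n≢0⇒n>0 λ ℓ≡0 →
  ℕP.n>0⇒n≢0 (product-pos 0<m 0<n)
    (trans (sym (gcd*lcm m n)) (trans (cong (gcd m n *_) ℓ≡0) (ℕP.*-zeroʳ (gcd m n))))

apery-⊕ : ∀ {S : ℕ → Set} {g b n} → (∀ {u v} → S u → S v → S (u + v)) →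
          (∀ {k} → S k → g ∣ k) → 0 < g → 0 < b → (∀ r → S (r * lcm g b)) →
          Apery (S ⊕ b) b n ⇔ Apery S (lcm g b) n
apery-⊕ {S} {g} {b} {n} S-+ g∣S 0<g 0<b ℓ-mult = mk⇔
  (λ ap@(_ , ¬sh) → apery-⊕-⊆ ap , λ sh → ¬sh (via-b sh))
  (λ (Sn , ¬sh) → ⊕-inj Sn , λ sh → ¬sh (via-ℓ Sn sh))
  where
  ℓ : ℕ
  ℓ = lcm g b

  -- ℓ = (c+1)·b, so n - ℓ ∈ S gives n - b = (n - ℓ) + c·b ∈ S + bℕ.
  via-b : Shifted ℓ S n → Shifted b (S ⊕ b) n
  via-b sh@(_ , S[n∸ℓ]) with n∣lcm[m,n] g b
  ... | divides zero    ℓ≡0  = contradiction ℓ≡0 (ℕP.n>0⇒n≢0 (lcm-pos 0<g 0<b))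
  ... | divides (suc c) ℓ≡cb = shifted-intro (S ⊕ b) b+w≡n (n ∸ ℓ , c , S[n∸ℓ] , refl)
    where
    b+w≡n : b + (n ∸ ℓ + c * b) ≡ n
    b+w≡n = trans (x+[y+z]≡x+z+y b (n ∸ ℓ) (c * b))
                  (trans (cong (_+ (n ∸ ℓ)) (sym ℓ≡cb)) (shifted-split {P = S} sh))

  -- n = s + (t+1)·b with s ∈ S; g divides n and s, hence (t+1)·b, so
  -- (t+1)·b = (r+1)·ℓ and n - ℓ = s + r·ℓ ∈ S.
  via-ℓ : S n → Shifted b (S ⊕ b) n → Shifted ℓ S n
  via-ℓ Sn sh@(_ , (s , t , Ss , s+tb≡n∸b)) = from-divisor (lcm-least g∣[t+1]b (n∣m*n (suc t)))
    where
    s+[t+1]b≡n : s + suc t * b ≡ n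
    s+[t+1]b≡n = trans (x+[y+z]≡y+[x+z] s b (t * b))
                       (trans (cong (b +_) s+tb≡n∸b) (shifted-split {P = S ⊕ b} sh))
    g∣[t+1]b : g ∣ suc t * b
    g∣[t+1]b = ∣m+n∣m⇒∣n (subst (g ∣_) (sym s+[t+1]b≡n) (g∣S Sn)) (g∣S Ss)
    from-divisor : ℓ ∣ suc t * b → Shifted ℓ S n
    from-divisor (divides zero    [t+1]b≡0) =
      contradiction [t+1]b≡0 (ℕP.n>0⇒n≢0 (product-pos {suc t} ℕP.0<1+n 0<b))
    from-divisor (divides (suc r) [t+1]b≡[r+1]ℓ) = shifted-intro S ℓ+w≡n (S-+ Ss (ℓ-mult r))
      where
      ℓ+w≡n : ℓ + (s + r * ℓ) ≡ n
      ℓ+w≡n = trans (x+[y+z]≡y+[x+z] ℓ s (r * ℓ))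
                    (trans (cong (s +_) (sym [t+1]b≡[r+1]ℓ)) s+[t+1]b≡n)

natSum1-cong : ∀ m {f g : ℕ → ℕ} → (∀ i → i ≤ m → f i ≡ g i) → natSum1 m f ≡ natSum1 m g
natSum1-cong zero    _   = refl
natSum1-cong (suc m) f≡g =
  cong₂ _+_ (natSum1-cong m (λ i i≤m → f≡g i (ℕP.m≤n⇒m≤1+n i≤m))) (f≡g (suc m) ℕP.≤-refl)

natSum1-+ : ∀ m (f g : ℕ → ℕ) → natSum1 m (λ i → f i + g i) ≡ natSum1 m f + natSum1 m g
natSum1-+ zero    f g = refl
natSum1-+ (suc m) f g =
  trans (cong (_+ (f (suc m) + g (suc m))) (natSum1-+ m f g))
        (+-interchange (natSum1 m f) (natSum1 m g) (f (suc m)) (g (suc m)))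

InS-zero : ∀ m a → InS m a 0
InS-zero m a = (λ _ → 0) , natSum1-zero m
  where
  natSum1-zero : ∀ m → natSum1 m (λ _ → 0) ≡ 0
  natSum1-zero zero    = refl
  natSum1-zero (suc m) = cong (_+ 0) (natSum1-zero m)

InS-+ : ∀ m a {u v} → InS m a u → InS m a v → InS m a (u + v)
InS-+ m a (x , Σx≡u) (y , Σy≡v) = (λ i → x i + y i) ,
  trans (natSum1-cong m (λ i _ → ℕP.*-distribʳ-+ (a i) (x i) (y i)))
        (trans (natSum1-+ m _ _) (cong₂ _+_ Σx≡u Σy≡v))

InS-base : ∀ a {n} → InS 0 a n ⇔ n ≡ 0
InS-base a = mk⇔ (λ (_ , 0≡n) → sym 0≡n) (λ n≡0 → (λ _ → 0) , sym n≡0)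

InS-suc : ∀ m a {n} → InS (suc m) a n ⇔ (InS m a ⊕ a (suc m)) n
InS-suc m a {n} = mk⇔ split join
  where
  split : InS (suc m) a n → (InS m a ⊕ a (suc m)) n
  split (x , Σ≡n) = natSum1 m (λ i → x i * a i) , x (suc m) , (x , refl) , Σ≡n
  join : (InS m a ⊕ a (suc m)) n → InS (suc m) a n
  join (s , t , (x , Σ≡s) , s+tb≡n) =
    x′ , trans (cong₂ _+_ (trans (natSum1-cong m old) Σ≡s) new) s+tb≡n
    where
    x′ : ℕ → ℕ
    x′ i = if does (i ≟ suc m) then t else x i
    old : ∀ i → i ≤ m → x′ i * a i ≡ x i * a i
    old i i≤m = cong (λ z → (if z then t else x i) * a i)
                     (dec-false (i ≟ suc m) (ℕP.<⇒≢ (s≤s i≤m)))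
    new : x′ (suc m) * a (suc m) ≡ t * a (suc m)
    new = cong (λ z → (if z then t else x (suc m)) * a (suc m)) (dec-true (suc m ≟ suc m) refl)

InS-generator : ∀ m a {j} → 1 ≤ j → j ≤ m → ∀ c → InS m a (c * a j)
InS-generator zero    a (s≤s _) ()
InS-generator (suc m) a 1≤j j≤1+m c with ℕP.m≤n⇒m<n∨m≡n j≤1+m
... | inj₁ (s≤s j≤m) = from (InS-suc m a) (⊕-inj (InS-generator m a 1≤j j≤m c))
... | inj₂ refl      = from (InS-suc m a) (0 , c , InS-zero m a , refl)

gcdUpTo-∣ : ∀ m a {n} → InS m a n → gcdUpTo a m ∣ n
gcdUpTo-∣ zero    a (_ , 0≡n) = subst (0 ∣_) 0≡n ∣-refl
gcdUpTo-∣ (suc m) a Sn with to (InS-suc m a) Sn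
... | s , t , Ss , s+tb≡n = subst (gcd g b ∣_) s+tb≡n
  (∣m∣n⇒∣m+n (∣-trans (gcd[m,n]∣m g b) (gcdUpTo-∣ m a Ss)) (∣-trans (gcd[m,n]∣n g b) (n∣m*n t)))
  where
  g b : ℕ
  g = gcdUpTo a m
  b = a (suc m)

Positive : ℕ → (ℕ → ℕ) → Set
Positive m a = ∀ i → 1 ≤ i → i ≤ m → 0 < a i

LcmCondition : ℕ → (ℕ → ℕ) → Set
LcmCondition m a = ∀ i → 2 ≤ i → i ≤ m → ∃[ j ] (1 ≤ j × j < i × ell a i ≡ lcm (a j) (a i))

positive-pred : ∀ {m a} → Positive (suc m) a → Positive m a
positive-pred pos i 1≤i i≤m = pos i 1≤i (ℕP.m≤n⇒m≤1+n i≤m)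

lcmCondition-pred : ∀ {m a} → LcmCondition (suc m) a → LcmCondition m a
lcmCondition-pred cond i 2≤i i≤m = cond i 2≤i (ℕP.m≤n⇒m≤1+n i≤m)

InS-dec : ∀ m a → Positive m a → Decidable (InS m a)
InS-dec zero    a _   n = map-dec (⇔-sym (InS-base a)) (n ≟ 0)
InS-dec (suc m) a pos n = map-dec (⇔-sym (InS-suc m a))
  (⊕-dec (pos (suc m) (s≤s z≤n) ℕP.≤-refl) (InS-dec m a (positive-pred pos)) n)

gcdUpTo-pos : ∀ m a → 0 < a (suc m) → 0 < gcdUpTo a (suc m)
gcdUpTo-pos m a 0<b = ℕP.n≢0⇒n>0 (gcd[m,n]≢0 (gcdUpTo a m) (a (suc m)) (inj₂ (ℕP.n>0⇒n≢0 0<b)))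

-- The lcm condition at i = m+2 puts every multiple of ℓ_{m+2} in S(a₁,…,a_{m+1}),
-- since ℓ_{m+2} = lcm(aⱼ, a_{m+2}) is a multiple of aⱼ.
ell-multiples : ∀ m a → LcmCondition (suc (suc m)) a → ∀ r → InS (suc m) a (r * ell a (suc (suc m)))
ell-multiples m a cond r with cond (suc (suc m)) (s≤s (s≤s z≤n)) ℕP.≤-refl
... | j , 1≤j , j<m+2 , ℓ≡lcm with m∣lcm[m,n] (a j) (a (suc (suc m)))
...   | divides c lcm≡caj = subst (InS (suc m) a) rcaj≡rℓ
          (InS-generator (suc m) a 1≤j (ℕP.≤-pred j<m+2) (r * c))
  where
  rcaj≡rℓ : r * c * a j ≡ r * ell a (suc (suc m))
  rcaj≡rℓ = trans (ℕP.*-assoc r c (a j)) (cong (r *_) (sym (trans ℓ≡lcm lcm≡caj)))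

InS-apery-indicator : ∀ m a {χ c} → Positive m a → InS m a c → IsIndicator (InS m a) χ →
                      IsIndicator (Apery (InS m a) c) (χ ⊛ oneMinusQ c)
InS-apery-indicator m a {c = c} pos Sc =
  apery-indicator c (InS-dec m a pos) (shifted-closed (InS-+ m a) Sc)

InS-apery-step : ∀ m a {n} → Positive (suc (suc m)) a → LcmCondition (suc (suc m)) a →
  Apery (InS (suc (suc m)) a) (a (suc (suc m))) n ⇔ Apery (InS (suc m) a) (ell a (suc (suc m))) n
InS-apery-step m a pos cond =
  apery-⊕ (InS-+ (suc m) a) (gcdUpTo-∣ (suc m) a) (gcdUpTo-pos m a (pos (suc m) (s≤s z≤n) (ℕP.n≤1+n _)))
          (pos (suc (suc m)) (s≤s z≤n) ℕP.≤-refl) (ell-multiples m a cond)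
  ⇔-∘ apery-cong (λ {k} → InS-suc (suc m) a {k})

denominator : ℕ → (ℕ → ℕ) → PS
denominator m a = prodFrom 1 m (λ i → oneMinusQ (a i))

numerator : ℕ → (ℕ → ℕ) → PS
numerator m a = prodFrom 2 (m ∸ 1) (λ i → oneMinusQ (ell a i))

-- (1 - q^{a₁}) χ₁ = 1, since Ap(a₁ℕ, a₁) = {0}.
first-factor : ∀ a {χ} → Positive 1 a → IsIndicator (InS 1 a) χ → χ ⊛ oneMinusQ (a 1) ≗ onePS
first-factor a pos χ-spec =
  indicator-unique (apery-dec (a 1) (InS-dec 1 a pos))
    (apery-⊕-zero (pos 1 ℕP.≤-refl ℕP.≤-refl) (InS-base a) ⇔-∘ apery-cong (λ {j} → InS-suc 0 a {j}))
    (InS-apery-indicator 1 a pos a₁∈S χ-spec)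
    onePS-indicator
  where
  a₁∈S : InS 1 a (a 1)
  a₁∈S = from (InS-suc 0 a) (0 , 1 , InS-zero 0 a , ℕP.*-identityˡ (a 1))

next-factor : ∀ m a {χ χ′} → Positive (suc (suc m)) a → LcmCondition (suc (suc m)) a →
  IsIndicator (InS (suc m) a) χ → IsIndicator (InS (suc (suc m)) a) χ′ →
  χ′ ⊛ oneMinusQ (a (suc (suc m))) ≗ χ ⊛ oneMinusQ (ell a (suc (suc m)))
next-factor m a pos cond χ-spec χ′-spec =
  indicator-unique (apery-dec (a (suc (suc m))) (InS-dec (suc (suc m)) a pos))
    (InS-apery-step m a pos cond)
    (InS-apery-indicator (suc (suc m)) a pos b∈S χ′-spec)
    (InS-apery-indicator (suc m) a (positive-pred pos) ℓ∈S χ-spec)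
  where
  b∈S : InS (suc (suc m)) a (a (suc (suc m)))
  b∈S = subst (InS (suc (suc m)) a) (ℕP.*-identityˡ _)
              (InS-generator (suc (suc m)) a (s≤s z≤n) ℕP.≤-refl 1)
  ℓ∈S : InS (suc m) a (ell a (suc (suc m)))
  ℓ∈S = subst (InS (suc m) a) (ℕP.*-identityˡ _) (ell-multiples m a cond 1)

-- The theorem, by induction on m: each new factor 1 - q^{a_{m+2}} is traded
-- for 1 - q^{ℓ_{m+2}} by next-factor, using commutativity and
-- associativity with factors 1 - q^c.
generating-function : ∀ m a → Positive m a → LcmCondition m a → ∀ χ → IsIndicator (InS m a) χ →
       χ ⊛ denominator m a ≗ numerator m a
generating-function zero a pos _ χ χ-spec = begin
  χ ⊛ onePS  ≈⟨ ⊛-comm χ onePS ⟩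
  onePS ⊛ χ  ≈⟨ onePS-⊛ χ ⟩
  χ          ≈⟨ indicator-unique (InS-dec 0 a pos) (InS-base a) χ-spec onePS-indicator ⟩
  onePS      ∎
  where open ≗-Reasoning
generating-function (suc zero) a pos _ χ χ-spec = begin
  χ ⊛ (onePS ⊛ oneMinusQ (a 1))  ≈⟨ ⊛-congˡ χ (onePS-⊛ (oneMinusQ (a 1))) ⟩
  χ ⊛ oneMinusQ (a 1)            ≈⟨ first-factor a pos χ-spec ⟩
  onePS                          ∎
  where open ≗-Reasoning
generating-function (suc (suc m)) a pos cond χ′ χ′-spec = begin
  χ′ ⊛ (D ⊛ B)       ≈⟨ ⊛-assoc-oneMinusQ χ′ D b ⟩
  (χ′ ⊛ D) ⊛ B       ≈⟨ ⊛-congʳ B (⊛-comm χ′ D) ⟩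
  (D ⊛ χ′) ⊛ B       ≈⟨ ⊛-assoc-oneMinusQ D χ′ b ⟨
  D ⊛ (χ′ ⊛ B)       ≈⟨ ⊛-congˡ D (next-factor m a pos cond χ-spec χ′-spec) ⟩
  D ⊛ (χ ⊛ L)        ≈⟨ ⊛-assoc-oneMinusQ D χ ℓ ⟩
  (D ⊛ χ) ⊛ L        ≈⟨ ⊛-congʳ L (⊛-comm D χ) ⟩
  (χ ⊛ D) ⊛ L        ≈⟨ ⊛-congʳ L
                          (generating-function (suc m) a (positive-pred pos) (lcmCondition-pred cond) χ χ-spec) ⟩
  numerator (suc m) a ⊛ L  ∎
  where
  open ≗-Reasoning
  b ℓ : ℕ
  b = a (suc (suc m))
  ℓ = ell a (suc (suc m))
  B L D χ : PS
  B = oneMinusQ b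
  L = oneMinusQ ℓ
  D = denominator (suc m) a
  χ = indicator (InS-dec (suc m) a (positive-pred pos))
  χ-spec : IsIndicator (InS (suc m) a) χ
  χ-spec = indicator-spec (InS-dec (suc m) a (positive-pred pos))

lemma3 : (m : ℕ) (a : ℕ → ℕ)
    → (∀ i → 1 ≤ i → i ≤ m → 0 < a i)
    → (∀ i → 2 ≤ i → i ≤ m → ∃[ j ] (1 ≤ j × j < i × ell a i ≡ lcm (a j) (a i)))
    → (χ : PS)
    → (∀ k → (InS m a k → χ k ≡ 1ℤ) × (¬ InS m a k → χ k ≡ 0ℤ))
    → ∀ n → (χ ⊛ prodFrom 1 m (λ i → oneMinusQ (a i))) n
    ≡ prodFrom 2 (m ∸ 1) (λ i → oneMinusQ (ell a i)) n
lemma3 = generating-function
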